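{- Let $G$ be a regular, non-complete graph on $n$ vertices which is a $t$-expander for a positive integer $t$. Then $\mathrm{box}(G)\ge\frac{n}{4(t-1)}$.
   Context: A graph $G=(V,E)$ is a $t$-expander if for every $S\subseteq V$ with $|S|=t$, $|\{v\in V\setminus S : uv\notin E\text{ for all }u\in S\}|<t$; equivalently the complement of $G$ contains no $K_{t,t}$ subgraph. The boxicity $\mathrm{box}(G)$ is the minimum $k$ such that there are interval graphs $I_1,\dots,I_k$ on $V$ with $E(G)=E(I_1)\cap\cdots\cap E(I_k)$. -}

module Defs where

open import Data.Nat using (ℕ; _≤_; _<_; _*_)
open import Data.Fin using (Fin)
open import Data.Fin.Subset using (Subset; ∣_∣)
open import Data.Bool using (Bool; true; false; _∧_; not)
open import Data.Vec using (tabulate; lookup)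
open import Data.List using (allFin)
open import Data.Bool.ListAction using (any)
open import Data.Product using (Σ; ∃; _×_; _,_)
open import Relation.Binary.PropositionalEquality using (_≡_; _≢_)
open import Function.Bundles using (_⇔_)

record Graph (n : ℕ) : Set where
  field
    adj     : Fin n → Fin n → Bool
    symm    : ∀ u v → adj u v ≡ adj v u
    irrefl  : ∀ v → adj v v ≡ false
open Graph public

Edge : ∀ {n} → Graph n → Fin n → Fin n → Set
Edge G u v = adj G u v ≡ true

nbhd : ∀ {n} → Graph n → Fin n → Subset n
nbhd G v = tabulate (adj G v)

degree : ∀ {n} → Graph n → Fin n → ℕ
degree G v = ∣ nbhd G v ∣

Regular : ∀ {n} → Graph n → Set
Regular {n} G = ∃ λ d → ∀ (v : Fin n) → degree G v ≡ d

Complete : ∀ {n} → Graph n → Set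
Complete {n} G = ∀ (u v : Fin n) → u ≢ v → Edge G u v

hasNbrIn : ∀ {n} → Graph n → Subset n → Fin n → Bool
hasNbrIn {n} G S w = any (λ u → lookup S u ∧ adj G u w) (allFin n)

nonNbrsOutside : ∀ {n} → Graph n → Subset n → Subset n
nonNbrsOutside G S = tabulate (λ w → not (lookup S w) ∧ not (hasNbrIn G S w))

Expander : ∀ {n} → ℕ → Graph n → Set
Expander {n} t G = ∀ (S : Subset n) → ∣ S ∣ ≡ t → ∣ nonNbrsOutside G S ∣ < t

-- An interval representation on Fin n: closed intervals [l v, r v]
-- (integer endpoints suffice for finite interval graphs).
record IntervalRep (n : ℕ) : Set where
  field
    left  : Fin n → ℕ
    right : Fin n → ℕ
    wf    : ∀ v → left v ≤ right v
open IntervalRep public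

IEdge : ∀ {n} → IntervalRep n → Fin n → Fin n → Set
IEdge I u v = (u ≢ v) × (left I u ≤ right I v) × (left I v ≤ right I u)

BoxRep : ∀ {n} → Graph n → ℕ → Set
BoxRep {n} G k = Σ (Fin k → IntervalRep n) λ I →
  ∀ (u v : Fin n) → Edge G u v ⇔ (∀ (j : Fin k) → IEdge (I j) u v)

-- box(G) ≥ num / den  for den > 0, with the division cleared:
-- boxicity is the least k admitting a BoxRep, so this says every k
-- admitting a box representation satisfies num ≤ den * k.
BoxicityAtLeastFrac : ∀ {n} → Graph n → (num den : ℕ) → Set
BoxicityAtLeastFrac G num den = ∀ k → BoxRep G k → num ≤ den * k

{-# OPTIONS --safe #-}
module Submission where

-- Fix interval graphs I₁ … I_k whose intersection is G. In each I_j, let R be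
-- least such that at least t intervals end by R, and let S be t of them. An
-- interval starting after R meets no interval of S, so it is a non-neighbour of
-- S outside S; by t-expansion fewer than t intervals start after R, and by the
-- choice of R fewer than t end before R. These at most 2(t - 1) vertices touch
-- every pair of disjoint intervals of I_j. Every non-edge of G is a pair of
-- disjoint intervals in some I_j, so the union C of these sets, of size at most
-- 2k(t - 1), is a vertex cover of the complement of G. That complement is
-- regular of positive degree, and counting its edges from both sides shows that
-- a vertex cover of a regular graph of positive degree contains at least half of
-- the vertices: n ≤ 2|C| ≤ 4k(t - 1).

open import Defs
open import Data.Bool using (Bool; true; false; not; _∧_; _∨_; T; T?)
open import Data.Bool.Properties using (T-≡; T-∧; T-∨; T-not-≡)
open import Data.Fin using (Fin; zero; suc; _≟_)
open import Data.Fin.Properties using (¬∀⟶∃¬)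
open import Data.Fin.Subset using (Subset; ∣_∣)
open import Data.List using (allFin)
open import Data.List.Relation.Unary.Any using (satisfied)
open import Data.List.Relation.Unary.Any.Properties using (any⁻)
open import Data.Nat using (ℕ; zero; suc; _+_; _*_; _∸_; _≤_; _<_; _⊔_; _<ᵇ_; _≤?_; _<?_; z≤n; s≤s; s≤s⁻¹; >-nonZero)
open import Data.Nat.Properties hiding (_≟_)
open import Data.Nat.Tactic.RingSolver using (solve-∀)
open import Data.Product using (∃; _×_; _,_; proj₁; proj₂)
open import Data.Sum as Sum using (_⊎_; inj₁; inj₂; swap)
open import Data.Unit using (tt)
open import Data.Empty using (⊥-elim)
open import Data.Vec using (tabulate; lookup)
open import Data.Vec.Functional using (_∷_)
open import Data.Vec.Properties using (lookup∘tabulate)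
open import Function using (_∘_; _⇔_; mk⇔; Equivalence)
open import Relation.Binary.PropositionalEquality
open import Relation.Nullary using (Dec; does; ¬_; yes; no; contradiction)
open import Relation.Nullary.Decidable using (_×-dec_; does-⇔)
open import Relation.Unary using (Decidable)
open import Algebra.Properties.CommutativeSemigroup +-commutativeSemigroup using (x∙yz≈y∙xz)
open import Algebra.Properties.Semiring.Sum +-*-semiring
  using (sum; sum-syntax; sum-cong-≗; sum-replicate-zero; ∑-distrib-+; ∑-comm; *-distribʳ-sum)

-- Counting Boolean predicates on Fin n

χ : Bool → ℕ
χ true  = 1
χ false = 0

count : ∀ {n} → (Fin n → Bool) → ℕ
count {n} P = ∑[ i < n ] χ (P i)

T-not-does : ∀ {a} {A : Set a} (a? : Dec A) → T (not (does a?)) ⇔ (¬ A)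
T-not-does (yes a) = mk⇔ (λ ()) (λ ¬a → ¬a a)
T-not-does (no ¬a) = mk⇔ (λ _ → ¬a) (λ _ → tt)

T-not : ∀ {x} → T (not x) ⇔ (¬ T x)
T-not {x} = T-not-does (T? x)

sum-mono-≤ : ∀ {n} {f g : Fin n → ℕ} → (∀ i → f i ≤ g i) → sum f ≤ sum g
sum-mono-≤ {zero}  f≤g = z≤n
sum-mono-≤ {suc n} f≤g = +-mono-≤ (f≤g zero) (sum-mono-≤ (f≤g ∘ suc))

count-cong : ∀ {n} {P Q : Fin n → Bool} → (∀ i → P i ≡ Q i) → count P ≡ count Q
count-cong P≗Q = sum-cong-≗ (cong χ ∘ P≗Q)

count-mono : ∀ {n} {P Q : Fin n → Bool} → (∀ i → T (P i) → T (Q i)) → count P ≤ count Q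
count-mono P⊆Q = sum-mono-≤ (χ-mono ∘ P⊆Q)
  where
  χ-mono : ∀ {x y} → (T x → T y) → χ x ≤ χ y
  χ-mono {false}        _   = z≤n
  χ-mono {true} {true}  _   = ≤-refl
  χ-mono {true} {false} x⇒y = ⊥-elim (x⇒y tt)

count-false : ∀ {n} → count {n} (λ _ → false) ≡ 0
count-false {n} = sum-replicate-zero n

count-true : ∀ {n} → count {n} (λ _ → true) ≡ n
count-true {zero}  = refl
count-true {suc n} = cong suc (count-true {n})

count-pos : ∀ {n} (P : Fin n → Bool) i → T (P i) → 0 < count P
count-pos P zero    Pi with P zero
... | true = s≤s z≤n
count-pos P (suc i) Pi = ≤-trans (count-pos (P ∘ suc) i Pi) (m≤n+m _ (χ (P zero)))

count-∨ : ∀ {n} (P Q : Fin n → Bool) → count (λ i → P i ∨ Q i) ≤ count P + count Q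
count-∨ P Q = begin
  count (λ i → P i ∨ Q i)           ≤⟨ sum-mono-≤ (λ i → χ-∨ (P i) (Q i)) ⟩
  ∑[ i < _ ] (χ (P i) + χ (Q i))    ≡⟨ ∑-distrib-+ (χ ∘ P) (χ ∘ Q) ⟩
  count P + count Q                 ∎
  where
  open ≤-Reasoning
  χ-∨ : ∀ x y → χ (x ∨ y) ≤ χ x + χ y
  χ-∨ true  _ = s≤s z≤n
  χ-∨ false _ = ≤-refl

count-not : ∀ {n} (P : Fin n → Bool) → count P + count (not ∘ P) ≡ n
count-not {n} P = begin
  count P + count (not ∘ P)             ≡⟨ ∑-distrib-+ (χ ∘ P) (χ ∘ not ∘ P) ⟨
  ∑[ i < n ] (χ (P i) + χ (not (P i)))  ≡⟨ sum-cong-≗ (χ+χ-not ∘ P) ⟩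
  count {n} (λ _ → true)                ≡⟨ count-true ⟩
  n                                     ∎
  where
  open ≡-Reasoning
  χ+χ-not : ∀ x → χ x + χ (not x) ≡ 1
  χ+χ-not true  = refl
  χ+χ-not false = refl

χ*count : ∀ {n} x (P : Fin n → Bool) → χ x * count P ≡ count (λ i → x ∧ P i)
χ*count     true  P = *-identityˡ (count P)
χ*count {n} false P = sym (count-false {n})

-- The conjunction is ordered so that the case v = zero holds definitionally.
count-remove : ∀ {n} (P : Fin n → Bool) v → count P ≡ χ (P v) + count (λ w → not (does (v ≟ w)) ∧ P w)
count-remove P zero    = refl
count-remove P (suc v) =
  trans (cong (χ (P zero) +_) (count-remove (P ∘ suc) v)) (x∙yz≈y∙xz (χ (P zero)) (χ (P (suc v))) _)

count-choose : ∀ {n} (P : Fin n → Bool) {t} → t ≤ count P →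
               ∃ λ Q → (∀ i → T (Q i) → T (P i)) × count Q ≡ t
count-choose {n} P {zero} _ = (λ _ → false) , (λ _ ()) , count-false {n}
count-choose {zero} P {suc t} ()
count-choose {suc n} P {suc t} t<∣P∣ with P zero in P₀
... | true  = let Q , Q⊆P , ∣Q∣ = count-choose (P ∘ suc) (s≤s⁻¹ t<∣P∣)
              in  true ∷ Q , (λ { zero _ → subst T (sym P₀) tt ; (suc i) → Q⊆P i }) , cong suc ∣Q∣
... | false = let Q , Q⊆P , ∣Q∣ = count-choose (P ∘ suc) t<∣P∣
              in  false ∷ Q , (λ { zero () ; (suc i) → Q⊆P i }) , ∣Q∣

∣tabulate∣≡count : ∀ {n} (P : Fin n → Bool) → ∣ tabulate P ∣ ≡ count P
∣tabulate∣≡count {zero}  P = refl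
∣tabulate∣≡count {suc n} P with P zero
... | true  = cong suc (∣tabulate∣≡count (P ∘ suc))
... | false = ∣tabulate∣≡count (P ∘ suc)

⋁ : ∀ {k n} → (Fin k → Fin n → Bool) → Fin n → Bool
⋁ {zero}  Z v = false
⋁ {suc k} Z v = Z zero v ∨ ⋁ (Z ∘ suc) v

⋁-intro : ∀ {k n} (Z : Fin k → Fin n → Bool) j {v} → T (Z j v) → T (⋁ Z v)
⋁-intro Z zero    Zv = Equivalence.from T-∨ (inj₁ Zv)
⋁-intro Z (suc j) Zv = Equivalence.from T-∨ (inj₂ (⋁-intro (Z ∘ suc) j Zv))

count-⋁ : ∀ {k n b} (Z : Fin k → Fin n → Bool) → (∀ j → count (Z j) ≤ b) → count (⋁ Z) ≤ k * b
count-⋁ {zero} {n} Z _ = ≤-reflexive (count-false {n})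
count-⋁ {suc k} {b = b} Z ∣Z∣≤b = begin
  count (⋁ Z)                          ≤⟨ count-∨ (Z zero) (⋁ (Z ∘ suc)) ⟩
  count (Z zero) + count (⋁ (Z ∘ suc)) ≤⟨ +-mono-≤ (∣Z∣≤b zero) (count-⋁ (Z ∘ suc) (∣Z∣≤b ∘ suc)) ⟩
  b + k * b                            ∎
  where open ≤-Reasoning

-- Vertex covers of regular graphs

VertexCover : ∀ {n} → (Fin n → Fin n → Bool) → (Fin n → Bool) → Set
VertexCover H C = ∀ v w → T (H v w) → T (C v) ⊎ T (C w)

module _ {n} (H : Fin n → Fin n → Bool) (H-sym : ∀ v w → H v w ≡ H w v) where

  ∑-degree-uncovered≤∑-degree-cover : ∀ {C} → VertexCover H C →
    ∑[ v < n ] (χ (not (C v)) * count (H v)) ≤ ∑[ w < n ] (χ (C w) * count (H w))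
  ∑-degree-uncovered≤∑-degree-cover {C} cover = begin
    ∑[ v < n ] (χ (not (C v)) * count (H v))    ≡⟨ sum-cong-≗ (λ v → χ*count (not (C v)) (H v)) ⟩
    ∑[ v < n ] count (λ w → not (C v) ∧ H v w)  ≤⟨ sum-mono-≤ (λ v → count-mono (neighbour-covered v)) ⟩
    ∑[ v < n ] count (λ w → C w ∧ H v w)        ≡⟨ ∑-comm (λ v w → χ (C w ∧ H v w)) ⟩
    ∑[ w < n ] count (λ v → C w ∧ H v w)        ≡⟨ sum-cong-≗ (λ w → count-cong (λ v → cong (C w ∧_) (H-sym v w))) ⟩
    ∑[ w < n ] count (λ v → C w ∧ H w v)        ≡⟨ sum-cong-≗ (λ w → χ*count (C w) (H w)) ⟨
    ∑[ w < n ] (χ (C w) * count (H w))          ∎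
    where
    open ≤-Reasoning
    neighbour-covered : ∀ v w → T (not (C v) ∧ H v w) → T (C w ∧ H v w)
    neighbour-covered v w ¬Cv∧Hvw with Equivalence.to T-∧ ¬Cv∧Hvw
    ... | ¬Cv , Hvw with cover v w Hvw
    ...   | inj₁ Cv = contradiction Cv (Equivalence.to T-not ¬Cv)
    ...   | inj₂ Cw = Equivalence.from T-∧ (Cw , Hvw)

  regular-cover-dominates : ∀ {δ C} → (∀ v → count (H v) ≡ δ) → 0 < δ → VertexCover H C →
                            count (not ∘ C) ≤ count C
  regular-cover-dominates {δ} {C} regular δ>0 cover =
    *-cancelʳ-≤ _ _ δ {{>-nonZero δ>0}} (begin
      count (not ∘ C) * δ                       ≡⟨ weigh (not ∘ C) ⟩
      ∑[ v < n ] (χ (not (C v)) * count (H v))  ≤⟨ ∑-degree-uncovered≤∑-degree-cover cover ⟩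
      ∑[ w < n ] (χ (C w) * count (H w))        ≡⟨ weigh C ⟨
      count C * δ                               ∎)
    where
    open ≤-Reasoning
    weigh : ∀ P → count P * δ ≡ ∑[ v < n ] (χ (P v) * count (H v))
    weigh P = trans (*-distribʳ-sum δ (χ ∘ P)) (sum-cong-≗ (λ v → cong (χ (P v) *_) (sym (regular v))))

-- The complement of a regular graph

nonAdjacent : ∀ {n} → Graph n → Fin n → Fin n → Bool
nonAdjacent G v w = not (does (v ≟ w)) ∧ not (adj G v w)

module _ {n} (G : Graph n) where

  nonAdjacent-sym : ∀ v w → nonAdjacent G v w ≡ nonAdjacent G w v
  nonAdjacent-sym v w =
    cong₂ (λ x y → not x ∧ not y) (does-⇔ (mk⇔ sym sym) (v ≟ w) (w ≟ v)) (symm G v w)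

  nonAdjacent⁻ : ∀ {v w} → T (nonAdjacent G v w) → v ≢ w × adj G v w ≡ false
  nonAdjacent⁻ {v} {w} vw with Equivalence.to T-∧ vw
  ... | v≢w , ¬vw = Equivalence.to (T-not-does (v ≟ w)) v≢w , Equivalence.to T-not-≡ ¬vw

  nonAdjacent⁺ : ∀ {v w} → v ≢ w → adj G v w ≡ false → T (nonAdjacent G v w)
  nonAdjacent⁺ {v} {w} v≢w ¬vw =
    Equivalence.from T-∧ (Equivalence.from (T-not-does (v ≟ w)) v≢w , Equivalence.from T-not-≡ ¬vw)

  count-nonAdjacent : ∀ {d} v → degree G v ≡ d → count (nonAdjacent G v) ≡ n ∸ suc d
  count-nonAdjacent {d} v deg = sym (begin
    n ∸ suc d                                        ≡⟨ cong (_∸ suc d) (count-not (adj G v)) ⟨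
    count (adj G v) + count (not ∘ adj G v) ∸ suc d  ≡⟨ cong₂ (λ a b → a + b ∸ suc d) deg-count co-degree ⟩
    d + suc (count (nonAdjacent G v)) ∸ suc d        ≡⟨ cong (_∸ suc d) (+-suc d _) ⟩
    suc d + count (nonAdjacent G v) ∸ suc d          ≡⟨ m+n∸m≡n (suc d) _ ⟩
    count (nonAdjacent G v)                          ∎)
    where
    open ≡-Reasoning
    deg-count : count (adj G v) ≡ d
    deg-count = trans (sym (∣tabulate∣≡count (adj G v))) deg
    co-degree : count (not ∘ adj G v) ≡ suc (count (nonAdjacent G v))
    co-degree rewrite count-remove (not ∘ adj G v) v | irrefl G v = refl

  co-degree-pos : ∀ {d} → (∀ v → degree G v ≡ d) → ¬ Complete G → 0 < n ∸ suc d
  co-degree-pos {d} regular ¬complete = n≢0⇒n>0 λ co-degree≡0 → ¬complete (complete co-degree≡0)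
    where
    complete : n ∸ suc d ≡ 0 → Complete G
    complete co-degree≡0 u v u≢v with adj G u v in uv
    ... | true  = refl
    ... | false = ⊥-elim (n≮n 0 (begin-strict
      0                        <⟨ count-pos (nonAdjacent G u) v (nonAdjacent⁺ u≢v uv) ⟩
      count (nonAdjacent G u)  ≡⟨ count-nonAdjacent u (regular u) ⟩
      n ∸ suc d                ≡⟨ co-degree≡0 ⟩
      0                        ∎))
      where open ≤-Reasoning

-- One interval supergraph of an expander

hasNbrIn⁻ : ∀ {n} (G : Graph n) S w → T (hasNbrIn G S w) → ∃ λ u → T (lookup S u ∧ adj G u w)
hasNbrIn⁻ {n} G S w = satisfied ∘ any⁻ _ (allFin n)

expander-nonNeighbours< : ∀ {n t} {G : Graph n} → Expander t G → (S X : Fin n → Bool) → count S ≡ t →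
  (∀ w → T (X w) → ¬ T (S w) × (∀ u → T (S u) → ¬ Edge G u w)) → count X < t
expander-nonNeighbours< {n} {t} {G} expander S X ∣S∣ isolated = begin-strict
  count X                  ≤⟨ count-mono X⊆N ⟩
  count N                  ≡⟨ ∣tabulate∣≡count N ⟨
  ∣ nonNbrsOutside G S′ ∣  <⟨ expander S′ (trans (∣tabulate∣≡count S) ∣S∣) ⟩
  t                        ∎
  where
  open ≤-Reasoning
  S′ : Subset n
  S′ = tabulate S
  N : Fin n → Bool
  N w = not (lookup S′ w) ∧ not (hasNbrIn G S′ w)
  S′∋⇒S : ∀ {u} → T (lookup S′ u) → T (S u)
  S′∋⇒S {u} = subst T (lookup∘tabulate S u)

  no-neighbour-in-S′ : ∀ {w} → (∀ u → T (S u) → ¬ Edge G u w) → ¬ T (hasNbrIn G S′ w)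
  no-neighbour-in-S′ {w} no-edge nbr with hasNbrIn⁻ G S′ w nbr
  ... | u , S′u∧uw with Equivalence.to T-∧ S′u∧uw
  ...   | S′u , uw = no-edge u (S′∋⇒S S′u) (Equivalence.to T-≡ uw)

  X⊆N : ∀ w → T (X w) → T (N w)
  X⊆N w Xw with isolated w Xw
  ... | w∉S , no-edge = Equivalence.from T-∧
    (Equivalence.from T-not (w∉S ∘ S′∋⇒S) , Equivalence.from T-not (no-neighbour-in-S′ no-edge))

persists-or-breaks : ∀ {p} {P : ℕ → Set p} → Decidable P → P 0 → ∀ N → P N ⊎ ∃ λ R → P R × ¬ P (suc R)
persists-or-breaks P? P0 zero = inj₁ P0
persists-or-breaks P? P0 (suc N) with persists-or-breaks P? P0 N
... | inj₂ breaks = inj₂ breaks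
... | inj₁ PN with P? (suc N)
...   | yes PsN = inj₁ PsN
...   | no ¬PsN = inj₂ (N , PN , ¬PsN)

bounded : ∀ {n} (f : Fin n → ℕ) → ∃ λ M → ∀ i → f i ≤ M
bounded {zero}  f = 0 , λ ()
bounded {suc n} f with bounded (f ∘ suc)
... | M , f∘suc≤M = f zero ⊔ M , λ { zero → m≤m⊔n (f zero) M ; (suc i) → m≤n⇒m≤o⊔n (f zero) (f∘suc≤M i) }

CoversDisjointPairs : ∀ {n} → IntervalRep n → (Fin n → Bool) → Set
CoversDisjointPairs I Z = ∀ a b → right I b < left I a → T (Z a) ⊎ T (Z b)

module _ {n s} {G : Graph n} (expander : Expander (suc s) G) (I : IntervalRep n)
         (edge-meets : ∀ u v → Edge G u v → left I v ≤ right I u) where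

  endsBefore : ℕ → Fin n → Bool
  endsBefore R w = right I w <ᵇ R

  startsAfter : ℕ → Fin n → Bool
  startsAfter R w = R <ᵇ left I w

  cover-at-threshold : ∀ R → count (endsBefore R) ≤ s → s < count (endsBefore (suc R)) →
                       ∃ λ Z → count Z ≤ s + s × CoversDisjointPairs I Z
  cover-at-threshold R few-end-before many-end-by =
    Z , ≤-trans (count-∨ (startsAfter R) (endsBefore R)) (+-mono-≤ few-start-after few-end-before) , cover
    where
    chosen : ∃ λ S → (∀ u → T (S u) → T (endsBefore (suc R) u)) × count S ≡ suc s
    chosen = count-choose (endsBefore (suc R)) many-end-by

    S : Fin n → Bool
    S = proj₁ chosen

    meets-S⇒starts-by-R : ∀ {u w} → T (S u) → left I w ≤ right I u → ¬ T (startsAfter R w)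
    meets-S⇒starts-by-R {u} {w} Su lw≤ru R<lw = n≮n R (begin-strict
      R         <⟨ <ᵇ⇒< R (left I w) R<lw ⟩
      left I w  ≤⟨ lw≤ru ⟩
      right I u ≤⟨ s≤s⁻¹ (<ᵇ⇒< (right I u) (suc R) (proj₁ (proj₂ chosen) u Su)) ⟩
      R         ∎)
      where open ≤-Reasoning

    few-start-after : count (startsAfter R) ≤ s
    few-start-after = s≤s⁻¹ (expander-nonNeighbours< {G = G} expander S (startsAfter R) (proj₂ (proj₂ chosen))
      λ w R<lw → (λ Sw → meets-S⇒starts-by-R Sw (wf I w) R<lw)
               , (λ u Su uw → meets-S⇒starts-by-R Su (edge-meets u w uw) R<lw))

    Z : Fin n → Bool
    Z w = startsAfter R w ∨ endsBefore R w

    cover : CoversDisjointPairs I Z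
    cover a b rb<la with R <? left I a
    ... | yes R<la = inj₁ (Equivalence.from T-∨ (inj₁ (<⇒<ᵇ R<la)))
    ... | no  R≮la = inj₂ (Equivalence.from T-∨ (inj₂ (<⇒<ᵇ (<-≤-trans rb<la (≮⇒≥ R≮la)))))

  rightBound : ℕ
  rightBound = proj₁ (bounded (right I))

  none-end-before-0 : count (endsBefore 0) ≤ s
  none-end-before-0 = subst (_≤ s) (sym (count-false {n})) z≤n

  all-end-by-rightBound : count {n} (λ _ → true) ≤ count (endsBefore (suc rightBound))
  all-end-by-rightBound = count-mono (λ w _ → <⇒<ᵇ (s≤s (proj₂ (bounded (right I)) w)))

  disjointPairCover : ∃ λ Z → count Z ≤ s + s × CoversDisjointPairs I Z
  disjointPairCover
    with persists-or-breaks (λ R → count (endsBefore R) ≤? s) none-end-before-0 (suc rightBound)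
  ... | inj₂ (R , few , ¬few) = cover-at-threshold R few (≰⇒> ¬few)
  ... | inj₁ few = (λ _ → true) , ≤-trans (≤-trans all-end-by-rightBound few) (m≤m+n s s) , λ _ _ _ → inj₁ tt

-- Box representations

Overlapping : ∀ {n} → IntervalRep n → Fin n → Fin n → Set
Overlapping I u v = left I u ≤ right I v × left I v ≤ right I u

nonOverlapping-covered : ∀ {n} {I : IntervalRep n} {Z} → CoversDisjointPairs I Z →
                         ∀ u v → ¬ Overlapping I u v → T (Z u) ⊎ T (Z v)
nonOverlapping-covered {I = I} cover u v ¬overlap with left I u ≤? right I v | left I v ≤? right I u
... | yes lu≤rv | yes lv≤ru = contradiction (lu≤rv , lv≤ru) ¬overlap
... | no  lu≰rv | _         = cover u v (≰⇒> lu≰rv)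
... | yes _     | no  lv≰ru = swap (cover v u (≰⇒> lv≰ru))

module _ {n k} {G : Graph n} (I : Fin k → IntervalRep n)
         (box : ∀ u v → Edge G u v ⇔ (∀ j → IEdge (I j) u v)) where

  edge-meets : ∀ j u v → Edge G u v → left (I j) v ≤ right (I j) u
  edge-meets j u v uv = proj₂ (proj₂ (Equivalence.to (box u v) uv j))

  nonAdjacent⇒separated : ∀ {v w} → T (nonAdjacent G v w) → ∃ λ j → ¬ Overlapping (I j) v w
  nonAdjacent⇒separated {v} {w} vw =
    ¬∀⟶∃¬ k _ (λ j → (left (I j) v ≤? right (I j) w) ×-dec (left (I j) w ≤? right (I j) v)) λ overlapping →
      let v≢w , ¬vw = nonAdjacent⁻ G vw
      in  contradiction (trans (sym (Equivalence.from (box v w) (λ j → v≢w , overlapping j))) ¬vw) λ ()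

  ⋁-covers-nonAdjacent : (Z : Fin k → Fin n → Bool) → (∀ j → CoversDisjointPairs (I j) (Z j)) →
                         VertexCover (nonAdjacent G) (⋁ Z)
  ⋁-covers-nonAdjacent Z cover v w vw =
    let j , separated = nonAdjacent⇒separated vw
    in  Sum.map (⋁-intro Z j) (⋁-intro Z j) (nonOverlapping-covered {I = I j} (cover j) v w separated)

corollary4 : (n t : ℕ) (G : Graph n) → 1 ≤ t → Regular G → ¬ Complete G → Expander t G →
    BoxicityAtLeastFrac G n (4 * (t ∸ 1))
corollary4 n (suc s) G _ (_ , regular) ¬complete expander k (I , box) = begin
  n                          ≡⟨ count-not C ⟨
  count C + count (not ∘ C)  ≤⟨ +-monoʳ-≤ (count C) C-dominates ⟩
  count C + count C          ≤⟨ +-mono-≤ ∣C∣ ∣C∣ ⟩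
  k * (s + s) + k * (s + s)  ≡⟨ arithmetic k s ⟩
  4 * s * k                  ∎
  where
  open ≤-Reasoning
  cover : ∀ j → ∃ λ Z → count Z ≤ s + s × CoversDisjointPairs (I j) Z
  cover j = disjointPairCover {G = G} expander (I j) (edge-meets {G = G} I box j)

  C : Fin n → Bool
  C = ⋁ (proj₁ ∘ cover)

  ∣C∣ : count C ≤ k * (s + s)
  ∣C∣ = count-⋁ (proj₁ ∘ cover) (proj₁ ∘ proj₂ ∘ cover)

  C-dominates : count (not ∘ C) ≤ count C
  C-dominates = regular-cover-dominates (nonAdjacent G) (nonAdjacent-sym G)
    (λ v → count-nonAdjacent G v (regular v)) (co-degree-pos G regular ¬complete)
    (⋁-covers-nonAdjacent {G = G} I box (proj₁ ∘ cover) (proj₂ ∘ proj₂ ∘ cover))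

  arithmetic : ∀ k s → k * (s + s) + k * (s + s) ≡ 4 * s * k
  arithmetic = solve-∀
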